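{- Let $n=2^k$ with $k>1$, and for each positive integer $m$ let $\Omega_m$ be the graph whose vertices are all $\pm1$-vectors of length $m$, two vertices being adjacent if and only if they are orthogonal. Then \[ \alpha(\Omega_n)\leq \frac{2^n}{n}. \] Furthermore, if $\alpha(\Omega_n)=\frac{2^n}{n}$, then also $\alpha(\Omega_{n/2})=\frac{2^{n/2}}{n/2}$.
   Context: $\alpha$ denotes the independence number. -}

module Defs where

open import Data.Bool using (Bool; true; false)
open import Data.Nat using (ℕ; _≤_; _*_; _^_)
open import Data.Integer using (ℤ; +_; -_; _+_; 0ℤ)
open import Data.Vec using (Vec; []; _∷_)
open import Data.List using (List; length)
open import Data.List.Relation.Unary.Unique.Propositional using (Unique)
open import Data.List.Membership.Propositional using (_∈_)
open import Data.Product using (_×_; Σ)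
open import Relation.Binary.PropositionalEquality using (_≡_)
open import Relation.Nullary using (¬_)

-- A ±1-vector of length m: true stands for +1, false for -1.
PMVec : ℕ → Set
PMVec m = Vec Bool m

sign : Bool → ℤ
sign true  = + 1
sign false = - (+ 1)

inner : ∀ {m} → PMVec m → PMVec m → ℤ
inner []       []       = 0ℤ
inner (x ∷ xs) (y ∷ ys) = sign x Data.Integer.* sign y + inner xs ys

Adj : ∀ {m} → PMVec m → PMVec m → Set
Adj u v = inner u v ≡ 0ℤ

IsIndependent : ∀ m → List (PMVec m) → Set
IsIndependent m S =
  Unique S × (∀ {u v} → u ∈ S → v ∈ S → ¬ Adj u v)

αΩ≤ : ℕ → ℕ → Set
αΩ≤ m N = ∀ (S : List (PMVec m)) → IsIndependent m S → length S ≤ N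

αΩ≡ : ℕ → ℕ → Set
αΩ≡ m N = αΩ≤ m N × Σ (List (PMVec m)) (λ S → IsIndependent m S × length S ≡ N)

{-# OPTIONS --safe #-}
-- Write u ∈ Ω_{2m} as x ‖ y with halves x, y ∈ Ω_m. If the coordinatewise
-- products xy and x'y' agree up to a global sign, then ⟨x ‖ y, x' ‖ y'⟩ is
-- either 2⟨x, x'⟩ or 0. Iterating this for n = 2^k gives a map
-- key : Ω_n → {±1}^(n - k), key (x ‖ y) = key x followed by xy up to sign,
-- such that two distinct vectors with the same key are orthogonal. Hence an
-- independent set injects into {±1}^(n - k), and α(Ω_n) ≤ 2^n / n.
-- If equality holds, key is a bijection on a maximum independent set I. For
-- each z ∈ {±1}^(n/2 - (k - 1)) pick the u = x ‖ y ∈ I whose key is z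
-- followed by +1's: the halves x are distinct (their keys are the z's), and
-- since all products xy agree, x ⊥ x' would force u ⊥ u'. So these halves
-- form an independent set of Ω_{n/2} of size 2^(n/2) / (n/2).
module Submission where

open import Defs
open import Data.Nat using (ℕ; _<_; _^_; _/_; _∸_)
open import Data.Nat.Properties using (m^n≢0)
open import Data.Product using (_×_)

open import Data.Bool using (true; false; not; _xor_)
import Data.Bool.Properties as Bool
open import Data.Empty using (⊥; ⊥-elim)
open import Data.Integer using (0ℤ; -_)
import Data.Integer as ℤ using (_+_; _*_)
import Data.Integer.Properties as ℤₚ
open import Data.List as List using (List; []; _∷_; length; [_])
open import Data.List.Membership.Propositional using (_∈_; _─_)
open import Data.List.Membership.Propositional.Properties using (∈-map⁺; ∈-map⁻; ∈-++⁺ˡ; ∈-++⁺ʳ)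
open import Data.List.Properties using (length-map; length-++; length-removeAt′)
open import Data.List.Relation.Binary.Subset.Propositional using (_⊆_)
open import Data.List.Relation.Binary.Subset.Propositional.Properties using (∈-∷⁺ʳ)
import Data.List.Relation.Unary.All as All
import Data.List.Relation.Unary.All.Properties as Allₚ
open import Data.List.Relation.Unary.AllPairs using ([]; _∷_)
open import Data.List.Relation.Unary.Any as Any using (here; there; index)
open import Data.List.Relation.Unary.Unique.Propositional using (Unique)
import Data.List.Relation.Unary.Unique.Propositional.Properties as Unique
open import Data.Nat using (zero; suc; pred; _+_; _*_; _≤_; z≤n; s≤s; NonZero)
open import Data.Nat.DivMod using (m*n/n≡m)
open import Data.Nat.Properties using (<⇒≱; ≤-reflexive; suc-pred; +-identityʳ; ^-distribˡ-+-*; module ≤-Reasoning)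
open import Data.Nat.Tactic.RingSolver using (solve-∀)
open import Data.Product using (∃₂; _,_; proj₂)
open import Data.Sum using (_⊎_; inj₁; inj₂; [_,_]′)
open import Data.Vec using (Vec; []; _∷_; _++_; zipWith; map; replicate; splitAt)
open import Data.Vec.Properties using (++-injective; ++-injectiveˡ; ∷-injectiveʳ; ≡-dec)
open import Function using (_∘_; id)
open import Relation.Binary.Definitions using (DecidableEquality)
open import Relation.Binary.PropositionalEquality using (_≡_; _≢_; refl; sym; trans; cong; cong₂; subst; ≢-sym; module ≡-Reasoning)
open import Relation.Nullary using (¬_; yes; no)

private
  variable
    A B : Set
    m n d : ℕ

-- x ⊕ y encodes the coordinatewise product of x and y: a coordinate is true
-- exactly where the product is -1.
infixl 6 _⊕_
_⊕_ : PMVec m → PMVec m → PMVec m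
_⊕_ = zipWith _xor_

⊕-cancelˡ : (x y : PMVec m) → x ⊕ (x ⊕ y) ≡ y
⊕-cancelˡ []      []      = refl
⊕-cancelˡ (a ∷ x) (b ∷ y) =
  cong₂ _∷_ (trans (sym (Bool.xor-assoc a a b)) (cong (_xor b) (Bool.xor-same a))) (⊕-cancelˡ x y)

⊕-injectiveʳ : (x : PMVec m) {y y' : PMVec m} → x ⊕ y ≡ x ⊕ y' → y ≡ y'
⊕-injectiveʳ x {y} {y'} eq = begin
  y             ≡⟨ ⊕-cancelˡ x y ⟨
  x ⊕ (x ⊕ y)   ≡⟨ cong (x ⊕_) eq ⟩
  x ⊕ (x ⊕ y')  ≡⟨ ⊕-cancelˡ x y' ⟩
  y'            ∎
  where open ≡-Reasoning

⊕-notʳ : (x y : PMVec m) → x ⊕ map not y ≡ map not (x ⊕ y)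
⊕-notʳ []      []      = refl
⊕-notʳ (a ∷ x) (b ∷ y) = cong₂ _∷_ (sym (Bool.not-distribʳ-xor a b)) (⊕-notʳ x y)

map-not-involutive : (v : PMVec m) → map not (map not v) ≡ v
map-not-involutive []      = refl
map-not-involutive (a ∷ v) = cong₂ _∷_ (Bool.not-involutive a) (map-not-involutive v)

inner-++ : (x x' : PMVec m) (y y' : PMVec n) →
           inner (x ++ y) (x' ++ y') ≡ inner x x' ℤ.+ inner y y'
inner-++ []      []        y y' = sym (ℤₚ.+-identityˡ (inner y y'))
inner-++ (a ∷ x) (a' ∷ x') y y' =
  trans (cong (λ t → sign a ℤ.* sign a' ℤ.+ t) (inner-++ x x' y y'))
        (sym (ℤₚ.+-assoc (sign a ℤ.* sign a') (inner x x') (inner y y')))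

inner-⊕ʳ : (x x' w : PMVec m) → inner (x ⊕ w) (x' ⊕ w) ≡ inner x x'
inner-⊕ʳ []      []        []      = refl
inner-⊕ʳ (a ∷ x) (a' ∷ x') (c ∷ w) = cong₂ ℤ._+_ (sign-xorʳ a a' c) (inner-⊕ʳ x x' w)
  where
  sign-xorʳ : ∀ a a' c → sign (a xor c) ℤ.* sign (a' xor c) ≡ sign a ℤ.* sign a'
  sign-xorʳ false false false = refl
  sign-xorʳ false false true  = refl
  sign-xorʳ false true  false = refl
  sign-xorʳ false true  true  = refl
  sign-xorʳ true  false false = refl
  sign-xorʳ true  false true  = refl
  sign-xorʳ true  true  false = refl
  sign-xorʳ true  true  true  = refl

inner-notʳ : (x y : PMVec m) → inner x (map not y) ≡ - inner x y
inner-notʳ []      []      = refl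
inner-notʳ (a ∷ x) (b ∷ y) =
  trans (cong₂ ℤ._+_ (sign-notʳ a b) (inner-notʳ x y))
        (sym (ℤₚ.neg-distrib-+ (sign a ℤ.* sign b) (inner x y)))
  where
  sign-notʳ : ∀ a b → sign a ℤ.* sign (not b) ≡ - (sign a ℤ.* sign b)
  sign-notʳ false false = refl
  sign-notʳ false true  = refl
  sign-notʳ true  false = refl
  sign-notʳ true  true  = refl

inner-⊕-≡ : (x y x' y' : PMVec m) → x' ⊕ y' ≡ x ⊕ y → inner y y' ≡ inner x x'
inner-⊕-≡ x y x' y' eq = begin
  inner y y'                            ≡⟨ cong₂ inner (⊕-cancelˡ x y) (⊕-cancelˡ x' y') ⟨
  inner (x ⊕ (x ⊕ y)) (x' ⊕ (x' ⊕ y'))  ≡⟨ cong (λ w → inner (x ⊕ (x ⊕ y)) (x' ⊕ w)) eq ⟩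
  inner (x ⊕ (x ⊕ y)) (x' ⊕ (x ⊕ y))   ≡⟨ inner-⊕ʳ x x' (x ⊕ y) ⟩
  inner x x'                            ∎
  where open ≡-Reasoning

inner-⊕-≡-not : (x y x' y' : PMVec m) → x' ⊕ y' ≡ map not (x ⊕ y) → inner y y' ≡ - inner x x'
inner-⊕-≡-not x y x' y' eq = begin
  inner y y'                            ≡⟨ cong₂ inner (⊕-cancelˡ x y) (⊕-cancelˡ x' y') ⟨
  inner (x ⊕ w) (x' ⊕ (x' ⊕ y'))        ≡⟨ cong (λ v → inner (x ⊕ w) (x' ⊕ v)) eq ⟩
  inner (x ⊕ w) (x' ⊕ map not w)        ≡⟨ cong (inner (x ⊕ w)) (⊕-notʳ x' w) ⟩
  inner (x ⊕ w) (map not (x' ⊕ w))      ≡⟨ inner-notʳ (x ⊕ w) (x' ⊕ w) ⟩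
  - inner (x ⊕ w) (x' ⊕ w)              ≡⟨ cong -_ (inner-⊕ʳ x x' w) ⟩
  - inner x x'                          ∎
  where
  open ≡-Reasoning
  w : PMVec _
  w = x ⊕ y

infixr 5 _‖_
_‖_ : Vec A m → Vec A m → Vec A (2 * m)
x ‖ y = x ++ y ++ []

‖-injective : {x y x' y' : Vec A m} → x ‖ y ≡ x' ‖ y' → x ≡ x' × y ≡ y'
‖-injective {x = x} {y} {x'} {y'} eq =
  let x≡x' , y[]≡y'[] = ++-injective x x' eq in x≡x' , ++-injectiveˡ y y' y[]≡y'[]

halves : ∀ m (u : Vec A (2 * m)) → ∃₂ λ x y → u ≡ x ‖ y
halves m u with splitAt m u
... | x , v , refl with splitAt m v
...   | y , [] , refl = x , y , refl

inner-‖ : (x y x' y' : PMVec m) → inner (x ‖ y) (x' ‖ y') ≡ inner x x' ℤ.+ inner y y'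
inner-‖ x y x' y' = begin
  inner (x ++ y ++ []) (x' ++ y' ++ [])      ≡⟨ inner-++ x x' (y ++ []) (y' ++ []) ⟩
  inner x x' ℤ.+ inner (y ++ []) (y' ++ [])  ≡⟨ cong (λ t → inner x x' ℤ.+ t) (inner-++ y y' [] []) ⟩
  inner x x' ℤ.+ (inner y y' ℤ.+ 0ℤ)         ≡⟨ cong (λ t → inner x x' ℤ.+ t) (ℤₚ.+-identityʳ (inner y y')) ⟩
  inner x x' ℤ.+ inner y y'                  ∎
  where open ≡-Reasoning

normalize : PMVec m → PMVec (pred m)
normalize []          = []
normalize (true  ∷ v) = v
normalize (false ∷ v) = map not v

normalize-≡ : (v v' : PMVec m) → normalize v ≡ normalize v' → v' ≡ v ⊎ v' ≡ map not v
normalize-≡ []          []           _  = inj₁ refl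
normalize-≡ (true  ∷ w) (true  ∷ w') eq = inj₁ (cong (true ∷_) (sym eq))
normalize-≡ (true  ∷ w) (false ∷ w') eq =
  inj₂ (cong (false ∷_) (trans (sym (map-not-involutive w')) (cong (map not) (sym eq))))
normalize-≡ (false ∷ w) (true  ∷ w') eq = inj₂ (cong (true ∷_) (sym eq))
normalize-≡ (false ∷ w) (false ∷ w') eq =
  inj₁ (cong (false ∷_) (trans (sym (map-not-involutive w'))
                               (trans (cong (map not) (sym eq)) (map-not-involutive w))))

‖-opposite-⊥ : (x y x' y' : PMVec m) → x' ⊕ y' ≡ map not (x ⊕ y) → Adj (x ‖ y) (x' ‖ y')
‖-opposite-⊥ x y x' y' eq = begin
  inner (x ‖ y) (x' ‖ y')      ≡⟨ inner-‖ x y x' y' ⟩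
  inner x x' ℤ.+ inner y y'    ≡⟨ cong (λ t → inner x x' ℤ.+ t) (inner-⊕-≡-not x y x' y' eq) ⟩
  inner x x' ℤ.+ - inner x x'  ≡⟨ ℤₚ.+-inverseʳ (inner x x') ⟩
  0ℤ                           ∎
  where open ≡-Reasoning

‖-⊥ : (x y x' y' : PMVec m) → normalize (x ⊕ y) ≡ normalize (x' ⊕ y') →
      Adj x x' → Adj (x ‖ y) (x' ‖ y')
‖-⊥ x y x' y' eq x⊥x' with normalize-≡ (x ⊕ y) (x' ⊕ y') eq
... | inj₂ opposite = ‖-opposite-⊥ x y x' y' opposite
... | inj₁ same     = begin
  inner (x ‖ y) (x' ‖ y')     ≡⟨ inner-‖ x y x' y' ⟩
  inner x x' ℤ.+ inner y y'   ≡⟨ cong (λ t → inner x x' ℤ.+ t) (inner-⊕-≡ x y x' y' same) ⟩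
  inner x x' ℤ.+ inner x x'   ≡⟨ cong₂ ℤ._+_ x⊥x' x⊥x' ⟩
  0ℤ                          ∎
  where open ≡-Reasoning

‖-≡⊎⊥ : (x y x' y' : PMVec m) → normalize (x ⊕ y) ≡ normalize (x' ⊕ y') →
        x ≡ x' ⊎ Adj x x' → x ‖ y ≡ x' ‖ y' ⊎ Adj (x ‖ y) (x' ‖ y')
‖-≡⊎⊥ x y x' y' eq (inj₂ x⊥x') = inj₂ (‖-⊥ x y x' y' eq x⊥x')
‖-≡⊎⊥ x y .x y' eq (inj₁ refl) with normalize-≡ (x ⊕ y) (x ⊕ y') eq
... | inj₁ same     = inj₁ (cong (x ‖_) (sym (⊕-injectiveʳ x same)))
... | inj₂ opposite = inj₂ (‖-opposite-⊥ x y x y' opposite)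

keyLength : ℕ → ℕ
keyLength zero    = 1
keyLength (suc k) = keyLength k + pred (2 ^ k)

key : ∀ k → PMVec (2 ^ k) → PMVec (keyLength k)
key zero    u = u
key (suc k) u with halves (2 ^ k) u
... | x , y , _ = key k x ++ normalize (x ⊕ y)

key-≡⇒≡⊎⊥ : ∀ k (u u' : PMVec (2 ^ k)) → key k u ≡ key k u' → u ≡ u' ⊎ Adj u u'
key-≡⇒≡⊎⊥ zero    u u' eq = inj₁ eq
key-≡⇒≡⊎⊥ (suc k) u u' eq with halves (2 ^ k) u | halves (2 ^ k) u'
... | x , y , refl | x' , y' , refl =
  let keys≡ , products≡ = ++-injective (key k x) (key k x') eq
  in  ‖-≡⊎⊥ x y x' y' products≡ (key-≡⇒≡⊎⊥ k x x' keys≡)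

Unique-map⁺-on : {f : A → B} {xs : List A} →
                 (∀ {x y} → x ∈ xs → y ∈ xs → f x ≡ f y → x ≡ y) →
                 Unique xs → Unique (List.map f xs)
Unique-map⁺-on {xs = []}     _     []             = []
Unique-map⁺-on {xs = x ∷ xs} f-inj (x∉xs ∷ uniq) =
  Allₚ.map⁺ (All.tabulate λ y∈xs → All.lookup x∉xs y∈xs ∘ f-inj (here refl) (there y∈xs))
  ∷ Unique-map⁺-on (λ x∈xs y∈xs → f-inj (there x∈xs) (there y∈xs)) uniq

∈-─⁺ : {x z : A} {ys : List A} (x∈ys : x ∈ ys) → z ∈ ys → z ≢ x → z ∈ ys ─ x∈ys
∈-─⁺ (here refl)  (here refl)  z≢x = ⊥-elim (z≢x refl)
∈-─⁺ (here _)     (there z∈ys) _   = z∈ys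
∈-─⁺ (there _)    (here z≡y)   _   = here z≡y
∈-─⁺ (there x∈ys) (there z∈ys) z≢x = there (∈-─⁺ x∈ys z∈ys z≢x)

Unique⇒length≤ : {xs ys : List A} → Unique xs → xs ⊆ ys → length xs ≤ length ys
Unique⇒length≤ {xs = []}                 _              _     = z≤n
Unique⇒length≤ {xs = x ∷ xs} {ys = ys} (x∉xs ∷ uniq) xs⊆ys = begin
  suc (length xs)          ≤⟨ s≤s (Unique⇒length≤ uniq xs⊆ys─x) ⟩
  suc (length (ys ─ x∈ys)) ≡⟨ length-removeAt′ ys (index x∈ys) ⟨
  length ys                ∎
  where
  open ≤-Reasoning
  x∈ys : x ∈ ys
  x∈ys = xs⊆ys (here refl)
  xs⊆ys─x : xs ⊆ ys ─ x∈ys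
  xs⊆ys─x z∈xs = ∈-─⁺ x∈ys (xs⊆ys (there z∈xs)) (≢-sym (All.lookup x∉xs z∈xs))

Unique⇒⊇ : DecidableEquality A → {xs ys : List A} →
           Unique xs → xs ⊆ ys → length ys ≤ length xs → ys ⊆ xs
Unique⇒⊇ _≟_ {xs} uniq xs⊆ys |ys|≤|xs| {z} z∈ys with Any.any? (z ≟_) xs
... | yes z∈xs = z∈xs
... | no  z∉xs = ⊥-elim (<⇒≱ (Unique⇒length≤ (Allₚ.¬Any⇒All¬ xs z∉xs ∷ uniq) (∈-∷⁺ʳ z∈ys xs⊆ys)) |ys|≤|xs|)

allPMVecs : ∀ d → List (PMVec d)
allPMVecs zero    = [ [] ]
allPMVecs (suc d) = List.map (true ∷_) (allPMVecs d) List.++ List.map (false ∷_) (allPMVecs d)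

∈-allPMVecs : (v : PMVec d) → v ∈ allPMVecs d
∈-allPMVecs []          = here refl
∈-allPMVecs (true  ∷ v) = ∈-++⁺ˡ (∈-map⁺ (true ∷_) (∈-allPMVecs v))
∈-allPMVecs (false ∷ v) = ∈-++⁺ʳ _ (∈-map⁺ (false ∷_) (∈-allPMVecs v))

allPMVecs-unique : ∀ d → Unique (allPMVecs d)
allPMVecs-unique zero    = All.[] ∷ []
allPMVecs-unique (suc d) =
  Unique.++⁺ (Unique.map⁺ ∷-injectiveʳ (allPMVecs-unique d))
             (Unique.map⁺ ∷-injectiveʳ (allPMVecs-unique d))
             heads-differ
  where
  heads-differ : ∀ {v} → v ∈ List.map (true ∷_) (allPMVecs d) × v ∈ List.map (false ∷_) (allPMVecs d) → ⊥
  heads-differ (v∈ , v∈') with ∈-map⁻ (true ∷_) v∈ | ∈-map⁻ (false ∷_) v∈'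
  ... | _ , _ , refl | _ , _ , ()

length-allPMVecs : ∀ d → length (allPMVecs d) ≡ 2 ^ d
length-allPMVecs zero    = refl
length-allPMVecs (suc d) = begin
  length (List.map (true ∷_) vs List.++ List.map (false ∷_) vs)
    ≡⟨ length-++ (List.map (true ∷_) vs) ⟩
  length (List.map (true ∷_) vs) + length (List.map (false ∷_) vs)
    ≡⟨ cong₂ _+_ (length-map (true ∷_) vs) (length-map (false ∷_) vs) ⟩
  length vs + length vs
    ≡⟨ cong (λ l → l + l) (length-allPMVecs d) ⟩
  2 ^ d + 2 ^ d
    ≡⟨ cong (2 ^ d +_) (+-identityʳ (2 ^ d)) ⟨
  2 ^ suc d
    ∎
  where
  open ≡-Reasoning
  vs : List (PMVec d)
  vs = allPMVecs d

Unique⇒length≤2^d : {S : List (PMVec d)} → Unique S → length S ≤ 2 ^ d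
Unique⇒length≤2^d {d} {S} uniq =
  subst (length S ≤_) (length-allPMVecs d) (Unique⇒length≤ uniq (λ {v} _ → ∈-allPMVecs v))

Unique∧length≡2^d⇒complete : {S : List (PMVec d)} → Unique S → length S ≡ 2 ^ d → (v : PMVec d) → v ∈ S
Unique∧length≡2^d⇒complete {d} {S} uniq |S| v =
  Unique⇒⊇ (≡-dec Bool._≟_) uniq (λ {w} _ → ∈-allPMVecs w)
    (≤-reflexive (trans (length-allPMVecs d) (sym |S|))) (∈-allPMVecs v)

keys-unique : ∀ k {S : List (PMVec (2 ^ k))} → IsIndependent (2 ^ k) S → Unique (List.map (key k) S)
keys-unique k {S} (uniq , indep) = Unique-map⁺-on key-injective uniq
  where
  key-injective : ∀ {u u'} → u ∈ S → u' ∈ S → key k u ≡ key k u' → u ≡ u'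
  key-injective u∈S u'∈S eq = [ id , ⊥-elim ∘ indep u∈S u'∈S ]′ (key-≡⇒≡⊎⊥ k _ _ eq)

independent≤2^keyLength : ∀ k → αΩ≤ (2 ^ k) (2 ^ keyLength k)
independent≤2^keyLength k S indS = begin
  length S                    ≡⟨ length-map (key k) S ⟨
  length (List.map (key k) S) ≤⟨ Unique⇒length≤2^d (keys-unique k indS) ⟩
  2 ^ keyLength k             ∎
  where open ≤-Reasoning

keyLength+k≡2^k : ∀ k → keyLength k + k ≡ 2 ^ k
keyLength+k≡2^k zero    = refl
keyLength+k≡2^k (suc k) = begin
  keyLength k + pred (2 ^ k) + suc k    ≡⟨ swap-summands (keyLength k) (pred (2 ^ k)) k ⟩
  keyLength k + k + suc (pred (2 ^ k))  ≡⟨ cong₂ _+_ (keyLength+k≡2^k k) (suc-pred (2 ^ k) {{m^n≢0 2 k}}) ⟩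
  2 ^ k + 2 ^ k                         ≡⟨ cong (2 ^ k +_) (+-identityʳ (2 ^ k)) ⟨
  2 ^ suc k                             ∎
  where
  open ≡-Reasoning
  swap-summands : ∀ a b c → a + b + suc c ≡ a + c + suc b
  swap-summands = solve-∀

2^n/n≡2^keyLength : ∀ k → (2 ^ (2 ^ k) / (2 ^ k)) {{m^n≢0 2 k}} ≡ 2 ^ keyLength k
2^n/n≡2^keyLength k = begin
  2 ^ (2 ^ k) / 2 ^ k                  ≡⟨ cong (λ e → 2 ^ e / 2 ^ k) (keyLength+k≡2^k k) ⟨
  2 ^ (keyLength k + k) / 2 ^ k        ≡⟨ cong (_/ 2 ^ k) (^-distribˡ-+-* 2 (keyLength k) k) ⟩
  2 ^ keyLength k * 2 ^ k / 2 ^ k      ≡⟨ m*n/n≡m (2 ^ keyLength k) (2 ^ k) ⟩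
  2 ^ keyLength k                      ∎
  where
  open ≡-Reasoning
  instance
    2^k≢0 : NonZero (2 ^ k)
    2^k≢0 = m^n≢0 2 k

module MaximumHalves (k : ℕ) (I : List (PMVec (2 ^ suc k))) (indI : IsIndependent _ I)
                     (|I| : length I ≡ 2 ^ keyLength (suc k)) where

  ones : PMVec (pred (2 ^ k))
  ones = replicate _ true

  record Preimage (z : PMVec (keyLength k)) : Set where
    field
      half other   : PMVec (2 ^ k)
      half‖other∈I : half ‖ other ∈ I
      key-half     : key k half ≡ z
      product      : normalize (half ⊕ other) ≡ ones
  open Preimage

  preimage : (z : PMVec (keyLength k)) → Preimage z
  preimage z with ∈-map⁻ (key (suc k)) (Unique∧length≡2^d⇒complete (keys-unique (suc k) indI)
                                      (trans (length-map (key (suc k)) I) |I|) (z ++ ones))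
  ... | u , u∈I , eq with halves (2 ^ k) u
  ...   | x , y , refl with ++-injective z (key k x) eq
  ...     | z≡ , ones≡ = record
    { half = x ; other = y ; half‖other∈I = u∈I ; key-half = sym z≡ ; product = sym ones≡ }

  J : List (PMVec (2 ^ k))
  J = List.map (half ∘ preimage) (allPMVecs (keyLength k))

  J-independent : IsIndependent (2 ^ k) J
  J-independent = Unique.map⁺ half-injective (allPMVecs-unique _) , J-¬Adj
    where
    half-injective : ∀ {z z'} → half (preimage z) ≡ half (preimage z') → z ≡ z'
    half-injective {z} {z'} eq =
      trans (sym (key-half (preimage z))) (trans (cong (key k) eq) (key-half (preimage z')))
    J-¬Adj : ∀ {a b} → a ∈ J → b ∈ J → ¬ Adj a b
    J-¬Adj a∈J b∈J with ∈-map⁻ (half ∘ preimage) a∈J | ∈-map⁻ (half ∘ preimage) b∈J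
    ... | z , _ , refl | z' , _ , refl = λ a⊥b →
      proj₂ indI (half‖other∈I (preimage z)) (half‖other∈I (preimage z'))
        (‖-⊥ (half (preimage z)) (other (preimage z)) (half (preimage z')) (other (preimage z'))
             (trans (product (preimage z)) (sym (product (preimage z')))) a⊥b)

  length-J : length J ≡ 2 ^ keyLength k
  length-J = trans (length-map (half ∘ preimage) (allPMVecs (keyLength k))) (length-allPMVecs (keyLength k))

mainTheorem9 : ∀ (k : ℕ) → 1 < k →
    αΩ≤ (2 ^ k) ((2 ^ (2 ^ k) / (2 ^ k)) {{m^n≢0 2 k}})
    × (αΩ≡ (2 ^ k) ((2 ^ (2 ^ k) / (2 ^ k)) {{m^n≢0 2 k}})
       → αΩ≡ (2 ^ (k ∸ 1)) ((2 ^ (2 ^ (k ∸ 1)) / (2 ^ (k ∸ 1))) {{m^n≢0 2 (k ∸ 1)}}))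
-- The argument only needs k ≥ 1.
mainTheorem9 zero    ()
mainTheorem9 (suc k) _ rewrite 2^n/n≡2^keyLength (suc k) | 2^n/n≡2^keyLength k =
  independent≤2^keyLength (suc k) ,
  λ (_ , I , indI , |I|) → let open MaximumHalves k I indI |I| in
    independent≤2^keyLength k , J , J-independent , length-J
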